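{- Let $B=B_1B_2\cdots B_\omega$ be a binary string with at least two symbols whose first two symbols are equal (so $|B_1|\ge 2$) and whose last block $B_\omega$ is a 1-block, and let $T=T(B)$. A set $S\subseteq V(T)$ is a power dominating set of $T$ if and only if there exists $v\in S$ such that (a) every 1-vertex lies in $N[v]$, and (b) every 0-block that is the block containing $v$ or follows it in $B$ has at most one vertex not in $S$.
   Context: For a binary string $B$, the threshold graph $T(B)$ has the symbols of $B$ as vertices, with an edge between symbols $x$ and $y$ ($x$ to the left of $y$) if and only if $y=1$. A block of $B$ is a maximal contiguous substring consisting only of 0s or only of 1s; $B=B_1\cdots B_\omega$ is the partition into blocks, a 0-block (1-block) consists of 0s (1s), and a 0-vertex (1-vertex) is a vertex lying in a 0-block (1-block). $N[v]$ is the closed neighborhood of $v$. For $S\subseteq V$, $S$ is a power dominating set if, after coloring $S$, coloring every neighbor of a vertex of $S$, and then repeatedly applying the forcing rule (a colored vertex with exactly one uncolored neighbor colors that neighbor) until no changes occur, all vertices are colored. -}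

module Defs where

open import Data.Bool using (Bool; true; false)
open import Data.Nat using (ℕ; _≤_; _<_)
open import Data.Fin using (Fin; toℕ)
open import Data.Fin.Subset using (Subset; _∈_; _∉_)
open import Data.Vec using (Vec; lookup)
open import Data.Product using (_×_; ∃)
open import Data.Sum using (_⊎_)
open import Relation.Binary.PropositionalEquality using (_≡_; _≢_)
open import Relation.Nullary using (¬_)

-- A binary string of length n is a Vec Bool n (true = symbol 1, false = symbol 0).
-- Vertices of T(B) are the positions Fin n.

-- Edge of the threshold graph T(B): positions x < y are adjacent iff B[y] = 1.
Adj : ∀ {n} → Vec Bool n → Fin n → Fin n → Set
Adj B x y = (toℕ x < toℕ y × lookup B y ≡ true) ⊎ (toℕ y < toℕ x × lookup B x ≡ true)

InClosedNbhd : ∀ {n} → Vec Bool n → Fin n → Fin n → Set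
InClosedNbhd B v u = u ≡ v ⊎ Adj B v u

-- Observed (coloured) vertices in the power domination process started from S:
-- the least set containing N[S] and closed under the forcing rule.
data Observed {n} (B : Vec Bool n) (S : Subset n) : Fin n → Set where
  dom   : ∀ {u v} → u ∈ S → InClosedNbhd B u v → Observed B S v
  force : ∀ {u v} → Observed B S u → Adj B u v →
          (∀ w → Adj B u w → w ≢ v → Observed B S w) → Observed B S v

IsPowerDominating : ∀ {n} → Vec Bool n → Subset n → Set
IsPowerDominating B S = ∀ v → Observed B S v

SameBlock : ∀ {n} → Vec Bool n → Fin n → Fin n → Set
SameBlock B x y = ∀ k →
  ((toℕ x ≤ toℕ k × toℕ k ≤ toℕ y) ⊎ (toℕ y ≤ toℕ k × toℕ k ≤ toℕ x)) →
  lookup B k ≡ lookup B x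

InBlockOfOrAfter : ∀ {n} → Vec Bool n → Fin n → Fin n → Set
InBlockOfOrAfter B v x = SameBlock B v x ⊎ toℕ v ≤ toℕ x

CondA : ∀ {n} → Vec Bool n → Fin n → Set
CondA B v = ∀ u → lookup B u ≡ true → InClosedNbhd B v u

CondB : ∀ {n} → Vec Bool n → Subset n → Fin n → Set
CondB B S v = ∀ x y → lookup B x ≡ false → InBlockOfOrAfter B v x → SameBlock B x y →
  x ∉ S → y ∉ S → x ≡ y

module Submission where

-- Two vertices in one block of B are twins of T(B): apart from each other
-- they have the same neighbours.  Twins that both lie outside N[S] are never coloured,
-- because a vertex adjacent to one of them is adjacent to both and so never has exactly
-- one uncoloured neighbour.  This gives necessity:
--   * call u "leading" if it is a 1-vertex or lies in the initial 0-block; such a vertex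
--     has every 1-vertex in N[u] (condition (a));
--   * if S has no leading vertex, the first two vertices (one block, as B[0] = B[1]) are
--     outside N[S], so S is not power dominating;
--   * otherwise the last leading vertex v of S satisfies (a), and two vertices outside S in
--     one 0-block at or after v's block would be undominated twins, so (b) holds.
-- For sufficiency we colour the vertices from left to right: everything except 0-vertices
-- x ∉ S at or after v's block is already in N[S] (N[v] contains all 1-vertices); such an x
-- is forced by the first 1-vertex y after x (it exists because B ends in 1), since y ∈ N[v]
-- and, by (b), all other neighbours of y are left of x or lie in N[S].

open import Defs
open import Data.Bool using (Bool; true; false)
import Data.Bool as Bool
open import Data.Bool.Properties using (¬-not)
open import Data.Nat using (ℕ; suc; _≤_; _<_; z≤n; s≤s; _≤?_)
open import Data.Nat.Properties using (≤-trans; ≤-<-trans; <⇒≤; <⇒≱; ≤-refl; ≤-total)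
open import Data.Fin using (Fin; zero; suc; fromℕ; toℕ)
open import Data.Fin.Properties using (_≟_; <-cmp; ≤∧≢⇒<; ≤fromℕ; all?)
open import Data.Fin.Induction using (<-wellFounded)
open import Data.Fin.Subset using (Subset; _∈_; _∉_)
open import Data.Fin.Subset.Properties using (_∈?_)
open import Data.Vec using (Vec; lookup)
open import Data.Product using (∃; _×_; _,_; proj₁; proj₂)
open import Data.Sum using (_⊎_; inj₁; inj₂; swap)
open import Data.Empty using (⊥-elim)
open import Function.Bundles using (_⇔_; mk⇔)
open import Induction.WellFounded using (module All)
open import Level using (0ℓ)
open import Relation.Binary.PropositionalEquality using (_≡_; refl; sym; trans; _≢_; ≢-sym; module ≡-Reasoning)
open import Relation.Binary.Definitions using (tri<; tri≈; tri>)
open import Relation.Nullary using (¬_; yes; no)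
open import Relation.Nullary.Decidable using (_×-dec_; _⊎-dec_; _→-dec_)
open import Relation.Unary using (Pred; Decidable)

true≢false : true ≢ false
true≢false ()

greatest : ∀ {n} (P : Pred (Fin n) 0ℓ) → Decidable P →
  (∃ λ v → P v × (∀ u → P u → toℕ u ≤ toℕ v)) ⊎ (∀ u → ¬ P u)
greatest {0} P P? = inj₂ (λ ())
greatest {suc n} P P? with greatest (λ u → P (suc u)) (λ u → P? (suc u))
... | inj₁ (v , pv , max) = inj₁ (suc v , pv , λ { zero _ → z≤n ; (suc u) pu → s≤s (max u pu) })
... | inj₂ none with P? zero
...   | yes p0 = inj₁ (zero , p0 , λ { zero _ → z≤n ; (suc u) pu → ⊥-elim (none u pu) })
...   | no ¬p0 = inj₂ (λ { zero p → ¬p0 p ; (suc u) p → none u p })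

least : ∀ {n} (P : Pred (Fin n) 0ℓ) → Decidable P →
  (∃ λ v → P v × (∀ u → P u → toℕ v ≤ toℕ u)) ⊎ (∀ u → ¬ P u)
least {0} P P? = inj₂ (λ ())
least {suc n} P P? with P? zero
... | yes p0 = inj₁ (zero , p0 , λ _ _ → z≤n)
... | no ¬p0 with least (λ u → P (suc u)) (λ u → P? (suc u))
...   | inj₁ (v , pv , min) = inj₁ (suc v , pv , λ { zero p → ⊥-elim (¬p0 p) ; (suc u) pu → s≤s (min u pu) })
...   | inj₂ none = inj₂ (λ { zero p → ¬p0 p ; (suc u) p → none u p })

module _ {n} (B : Vec Bool n) where

  adj-sym : ∀ {x y} → Adj B x y → Adj B y x
  adj-sym = swap

  adj-zero : ∀ {u w} → lookup B w ≡ false → Adj B u w → toℕ w < toℕ u × lookup B u ≡ true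
  adj-zero bw (inj₁ (_ , bw′)) = ⊥-elim (true≢false (trans (sym bw′) bw))
  adj-zero bw (inj₂ w<u,bu) = w<u,bu

  sameBlock-lookup : ∀ {x y} → SameBlock B x y → lookup B y ≡ lookup B x
  sameBlock-lookup {x} {y} sb with ≤-total (toℕ x) (toℕ y)
  ... | inj₁ x≤y = sb y (inj₁ (x≤y , ≤-refl))
  ... | inj₂ y≤x = sb y (inj₂ (≤-refl , y≤x))

  sameBlock-sym : ∀ {x y} → SameBlock B x y → SameBlock B y x
  sameBlock-sym {x} {y} sb k between = trans (sb k (swap between)) (sym (sameBlock-lookup sb))

  sameBlock-twin : ∀ {x y} → SameBlock B x y → ∀ u → Adj B u x → u ≢ y → Adj B u y
  sameBlock-twin {x} {y} sb u adj u≢y with <-cmp u y | adj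
  ... | tri≈ _ u≡y _ | _                = ⊥-elim (u≢y u≡y)
  ... | tri< u<y _ _ | inj₁ (_ , bx)    = inj₁ (u<y , trans (sameBlock-lookup sb) bx)
  ... | tri< u<y _ _ | inj₂ (x<u , bu)  =
        inj₁ (u<y , trans (sameBlock-lookup sb) (trans (sym (sb u (inj₁ (<⇒≤ x<u , <⇒≤ u<y)))) bu))
  ... | tri> _ _ y<u | inj₁ (u<x , bx)  = inj₂ (y<u , trans (sb u (inj₂ (<⇒≤ y<u , <⇒≤ u<x))) bx)
  ... | tri> _ _ y<u | inj₂ (_ , bu)    = inj₂ (y<u , bu)

module _ {n} (B : Vec Bool n) (S : Subset n) where

  Undominated : Fin n → Set
  Undominated x = ∀ u → u ∈ S → ¬ InClosedNbhd B u x

  twins-unobserved : ∀ {x y} → x ≢ y →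
    (∀ u → Adj B u x → u ≢ y → Adj B u y) → (∀ u → Adj B u y → u ≢ x → Adj B u x) →
    Undominated x → Undominated y → ∀ w → Observed B S w → w ≢ x × w ≢ y
  twins-unobserved x≢y x→y y→x ux uy w (dom u∈S nb) =
    (λ { refl → ux _ u∈S nb }) , (λ { refl → uy _ u∈S nb })
  twins-unobserved {x} {y} x≢y x→y y→x ux uy w (force {u} ou adj others)
    with twins-unobserved x≢y x→y y→x ux uy u ou
  ... | u≢x , u≢y =
    (λ { refl → proj₂ (recurse y (others y (x→y u adj u≢y) (≢-sym x≢y))) refl }) ,
    (λ { refl → proj₁ (recurse x (others x (y→x u adj u≢x) x≢y)) refl })
    where
    recurse : ∀ w → Observed B S w → w ≢ x × w ≢ y
    recurse = twins-unobserved x≢y x→y y→x ux uy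

  sameBlock-unobserved : ∀ {x y} → x ≢ y → SameBlock B x y →
    Undominated x → Undominated y → ¬ IsPowerDominating B S
  sameBlock-unobserved {x} x≢y sb ux uy pd =
    proj₁ (twins-unobserved x≢y (sameBlock-twin B sb) (sameBlock-twin B (sameBlock-sym B sb))
                            ux uy x (pd x)) refl

  sameBlock-undominated : ∀ {x y} → SameBlock B x y → y ∉ S → Undominated x → Undominated y
  sameBlock-undominated sb y∉S ux u u∈S (inj₁ refl) = y∉S u∈S
  sameBlock-undominated {x} sb y∉S ux u u∈S (inj₂ adj) with u ≟ x
  ... | yes refl = ux u u∈S (inj₁ refl)
  ... | no u≢x   = ux u u∈S (inj₂ (sameBlock-twin B (sameBlock-sym B sb) u adj u≢x))

module _ {n} (B : Vec Bool n) where

  Leading : Fin n → Set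
  Leading u = lookup B u ≡ true ⊎ (∀ k → toℕ k ≤ toℕ u → lookup B k ≡ false)

  leading? : Decidable Leading
  leading? u = (lookup B u Bool.≟ true) ⊎-dec all? (λ k → (toℕ k ≤? toℕ u) →-dec (lookup B k Bool.≟ false))

  leading⇒condA : ∀ {v} → Leading v → CondA B v
  leading⇒condA {v} lv t bt with <-cmp t v | lv
  ... | tri≈ _ t≡v _ | _          = inj₁ t≡v
  ... | tri> _ _ v<t | _          = inj₂ (inj₁ (v<t , bt))
  ... | tri< t<v _ _ | inj₁ bv    = inj₂ (inj₂ (t<v , bv))
  ... | tri< t<v _ _ | inj₂ zeros = ⊥-elim (true≢false (trans (sym bt) (zeros t (<⇒≤ t<v))))

module _ {n} (B : Vec Bool n) (S : Subset n) {v : Fin n}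
         (maximal : ∀ u → u ∈ S → Leading B u → toℕ u ≤ toℕ v) where

  -- If v is the last leading vertex of S, a 0-vertex outside S lying in v's block or after
  -- it is undominated: its only neighbours are later 1-vertices, which are leading.
  late-zero-undominated : ∀ {x} → lookup B x ≡ false → InBlockOfOrAfter B v x → x ∉ S →
    Undominated B S x
  late-zero-undominated bx late x∉S u u∈S (inj₁ refl) = x∉S u∈S
  late-zero-undominated {x} bx late x∉S u u∈S (inj₂ adj) with adj-zero B bx adj | late
  ... | x<u , bu | inj₂ v≤x = <⇒≱ x<u (≤-trans (maximal u u∈S (inj₁ bu)) v≤x)
  ... | x<u , bu | inj₁ sbv = true≢false (begin
    true            ≡⟨ sym bu ⟩
    lookup B u      ≡⟨ sbv u (inj₂ (<⇒≤ x<u , maximal u u∈S (inj₁ bu))) ⟩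
    lookup B v      ≡⟨ sym (sameBlock-lookup B sbv) ⟩
    lookup B x      ≡⟨ bx ⟩
    false           ∎)
    where open ≡-Reasoning

  -- Condition (b) for the last leading vertex of a power dominating set: two distinct
  -- vertices outside S of such a 0-block would be undominated twins.
  maximal⇒condB : IsPowerDominating B S → CondB B S v
  maximal⇒condB pd x y bx late sb x∉S y∉S with x ≟ y
  ... | yes x≡y = x≡y
  ... | no x≢y  = ⊥-elim (sameBlock-unobserved B S x≢y sb ux (sameBlock-undominated B S sb y∉S ux) pd)
    where
    ux : Undominated B S x
    ux = late-zero-undominated bx late x∉S

module _ {m} (B : Vec Bool (suc (suc m))) (first-two : lookup B zero ≡ lookup B (suc zero)) where

  initial-symbol : ∀ k → toℕ k ≤ 1 → lookup B k ≡ lookup B zero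
  initial-symbol zero          _           = refl
  initial-symbol (suc zero)    _           = sym first-two
  initial-symbol (suc (suc k)) (s≤s ())

  initial-block : SameBlock B zero (suc zero)
  initial-block k (inj₁ (_ , k≤1)) = initial-symbol k k≤1
  initial-block k (inj₂ (_ , k≤0)) = initial-symbol k (≤-trans k≤0 z≤n)

  initial-leading : ∀ u → toℕ u ≤ 1 → Leading B u
  initial-leading u u≤1 with lookup B u Bool.≟ true
  ... | yes bu = inj₁ bu
  ... | no ¬bu = inj₂ λ k k≤u → begin
    lookup B k    ≡⟨ initial-symbol k (≤-trans k≤u u≤1) ⟩
    lookup B zero ≡⟨ sym (initial-symbol u u≤1) ⟩
    lookup B u    ≡⟨ ¬-not ¬bu ⟩
    false         ∎
    where open ≡-Reasoning

  -- If no vertex of S is leading, the first two vertices are undominated: any vertex in the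
  -- closed neighbourhood of one of them is leading.
  initial-undominated : (S : Subset (suc (suc m))) → (∀ u → u ∈ S → ¬ Leading B u) →
    ∀ w → toℕ w ≤ 1 → Undominated B S w
  initial-undominated S none w w≤1 u u∈S (inj₁ refl)                = none u u∈S (initial-leading u w≤1)
  initial-undominated S none w w≤1 u u∈S (inj₂ (inj₁ (u<w , _))) = none u u∈S (initial-leading u (≤-trans (<⇒≤ u<w) w≤1))
  initial-undominated S none w w≤1 u u∈S (inj₂ (inj₂ (_ , bu)))  = none u u∈S (inj₁ bu)

  -- Necessity: a power dominating set contains a vertex satisfying (a) and (b), namely its
  -- last leading vertex, which exists since otherwise the first two vertices stay uncoloured.
  necessity : (S : Subset (suc (suc m))) → IsPowerDominating B S →
    ∃ λ v → v ∈ S × CondA B v × CondB B S v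
  necessity S pd with greatest (λ u → u ∈ S × Leading B u) (λ u → (u ∈? S) ×-dec leading? B u)
  ... | inj₁ (v , (v∈S , lv) , max) =
        v , v∈S , leading⇒condA B lv , maximal⇒condB B S (λ u u∈S lu → max u (u∈S , lu)) pd
  ... | inj₂ none = ⊥-elim (sameBlock-unobserved B S (λ ()) initial-block
                              (initial-undominated S leadless zero z≤n)
                              (initial-undominated S leadless (suc zero) (s≤s z≤n)) pd)
    where
    leadless : ∀ u → u ∈ S → ¬ Leading B u
    leadless u u∈S lu = none u (u∈S , lu)

module _ {n} (B : Vec Bool n) {v : Fin n} (condA : CondA B v) where

  -- If v is a 0-vertex with every 1-vertex in N[v], no 1 precedes v (its neighbours all
  -- follow it).
  condA-zero-prefix : lookup B v ≡ false → ∀ k → toℕ k ≤ toℕ v → lookup B k ≡ false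
  condA-zero-prefix bv k k≤v with lookup B k Bool.≟ true
  ... | no ¬bk = ¬-not ¬bk
  ... | yes bk with condA k bk
  ...   | inj₁ refl = bv
  ...   | inj₂ adj  = ⊥-elim (<⇒≱ (proj₁ (adj-zero B bv (adj-sym B adj))) k≤v)

  dominated-or-late : ∀ x → InClosedNbhd B v x ⊎ InBlockOfOrAfter B v x
  dominated-or-late x with <-cmp x v | lookup B v Bool.≟ true
  ... | tri≈ _ x≡v _ | _      = inj₁ (inj₁ x≡v)
  ... | tri> _ _ v<x | _      = inj₂ (inj₂ (<⇒≤ v<x))
  ... | tri< x<v _ _ | yes bv = inj₁ (inj₂ (inj₂ (x<v , bv)))
  ... | tri< x<v _ _ | no ¬bv = inj₂ (inj₁ λ k between → trans (zero-prefix k (k≤v between)) (sym bv))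
    where
    bv : lookup B v ≡ false
    bv = ¬-not ¬bv
    zero-prefix : ∀ k → toℕ k ≤ toℕ v → lookup B k ≡ false
    zero-prefix = condA-zero-prefix bv
    k≤v : ∀ {k} → toℕ v ≤ toℕ k × toℕ k ≤ toℕ x ⊎ toℕ x ≤ toℕ k × toℕ k ≤ toℕ v → toℕ k ≤ toℕ v
    k≤v (inj₁ (_ , k≤x)) = ≤-trans k≤x (<⇒≤ x<v)
    k≤v (inj₂ (_ , k≤v)) = k≤v

module _ {n} (B : Vec Bool n) where

  first-one-after : ∀ {x} → lookup B x ≡ false → (∃ λ y → toℕ x < toℕ y × lookup B y ≡ true) →
    ∃ λ y → toℕ x < toℕ y × lookup B y ≡ true ×
            (∀ w → toℕ x < toℕ w → toℕ w < toℕ y → SameBlock B x w)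
  first-one-after {x} bx (y₀ , p₀) with least (λ y → toℕ x < toℕ y × lookup B y ≡ true)
                                             (λ y → (suc (toℕ x) ≤? toℕ y) ×-dec (lookup B y Bool.≟ true))
  ... | inj₂ none = ⊥-elim (none y₀ p₀)
  ... | inj₁ (y , (x<y , by) , first) = y , x<y , by , λ w x<w w<y k between →
        trans (zero-between k between x<w w<y) (sym bx)
    where
    zero-between : ∀ {w} k → toℕ x ≤ toℕ k × toℕ k ≤ toℕ w ⊎ toℕ w ≤ toℕ k × toℕ k ≤ toℕ x →
      toℕ x < toℕ w → toℕ w < toℕ y → lookup B k ≡ false
    zero-between k (inj₂ (w≤k , k≤x)) x<w _ = ⊥-elim (<⇒≱ x<w (≤-trans w≤k k≤x))
    zero-between k (inj₁ (x≤k , k≤w)) _ w<y with lookup B k Bool.≟ true | k ≟ x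
    ... | no ¬bk | _        = ¬-not ¬bk
    ... | yes bk | yes refl = bx
    ... | yes bk | no k≢x   = ⊥-elim (<⇒≱ (≤-<-trans k≤w w<y) (first k (≤∧≢⇒< x≤k (≢-sym k≢x) , bk)))

module _ {n} (B : Vec Bool n) (S : Subset n)
         (one-after-zero : ∀ x → lookup B x ≡ false → ∃ λ y → toℕ x < toℕ y × lookup B y ≡ true)
         {v : Fin n} (v∈S : v ∈ S) (condA : CondA B v) (condB : CondB B S v) where

  dominated-or-late-zero : ∀ w → Observed B S w ⊎ (lookup B w ≡ false × w ∉ S × InBlockOfOrAfter B v w)
  dominated-or-late-zero w with w ∈? S | lookup B w Bool.≟ true | dominated-or-late B condA w
  ... | yes w∈S | _      | _         = inj₁ (dom w∈S (inj₁ refl))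
  ... | no _    | yes bw | _         = inj₁ (dom v∈S (condA w bw))
  ... | no _    | no _   | inj₁ nbv  = inj₁ (dom v∈S nbv)
  ... | no w∉S  | no ¬bw | inj₂ late = inj₂ (¬-not ¬bw , w∉S , late)

  -- Once all vertices left of x are coloured, x is coloured: a late 0-vertex x ∉ S is the
  -- only uncoloured neighbour of the first 1-vertex y after it: the other neighbours of y
  -- right of x are 1-vertices or, by (b), vertices of S in x's block.
  observed-step : ∀ x → (∀ {w} → toℕ w < toℕ x → Observed B S w) → Observed B S x
  observed-step x earlier with dominated-or-late-zero x
  ... | inj₁ obs = obs
  ... | inj₂ (bx , x∉S , late) with first-one-after B bx (one-after-zero x bx)
  ...   | y , x<y , by , block = force (dom v∈S (condA y by)) (inj₂ (x<y , by)) others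
    where
    others : ∀ w → Adj B y w → w ≢ x → Observed B S w
    others w adj w≢x with <-cmp w x | dominated-or-late-zero w
    ... | tri< w<x _ _ | _                  = earlier w<x
    ... | tri≈ _ w≡x _ | _                  = ⊥-elim (w≢x w≡x)
    ... | tri> _ _ _   | inj₁ obs           = obs
    ... | tri> _ _ x<w | inj₂ (bw , w∉S , _) =
          ⊥-elim (w≢x (sym (condB x w bx late (block w x<w (proj₁ (adj-zero B bw adj))) x∉S w∉S)))

  sufficiency : IsPowerDominating B S
  sufficiency = All.wfRec <-wellFounded 0ℓ (Observed B S) observed-step

theorem22 : (m : ℕ) (B : Vec Bool (suc (suc m))) →
    lookup B zero ≡ lookup B (suc zero) →
    lookup B (fromℕ (suc m)) ≡ true →
    (S : Subset (suc (suc m))) →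
    IsPowerDominating B S ⇔ ∃ λ v → v ∈ S × CondA B v × CondB B S v
theorem22 m B first-two last-one S =
  mk⇔ (necessity B first-two S)
      (λ (v , v∈S , condA , condB) → sufficiency B S one-after-zero v∈S condA condB)
  where
  one-after-zero : ∀ x → lookup B x ≡ false → ∃ λ y → toℕ x < toℕ y × lookup B y ≡ true
  one-after-zero x bx = fromℕ (suc m) , ≤∧≢⇒< (≤fromℕ x) x≢last , last-one
    where
    x≢last : x ≢ fromℕ (suc m)
    x≢last refl = true≢false (trans (sym last-one) bx)
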